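{- Let $p$ be a prime and let $A=(a_1,\dots,a_\ell)$ be a sequence of $\ell\geqslant1$ nonzero elements of $\mathbb{F}_p$ such that $\sigma(A)\neq0$, and let $A'=(a_1,\dots,a_\ell,-\sigma(A))$. Then $\sigma(A')=0$ and $\dim(A')=\dim(A)+1$.
   Context: $\sigma(A)=a_1+\dots+a_\ell$. For a sequence $C=(c_1,\dots,c_m)$ of nonzero elements of $\mathbb{F}_p$, $\mathcal{S}_C=\{x\in\{0,1\}^m : \sum_i c_ix_i=0 \text{ in } \mathbb{F}_p\}$ and $\dim(C)$ is the dimension of the $\mathbb{F}_p$-linear span of $\mathcal{S}_C$ in $\mathbb{F}_p^m$. -}

module Defs where

open import Data.Nat using (ℕ; zero; suc; NonZero; _∸_)
import Data.Nat as ℕ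
open import Data.Nat.DivMod using (_mod_)
open import Data.Fin using (Fin; toℕ)
open import Data.Bool using (Bool; true; false)
open import Data.Vec using (Vec; []; _∷_; _∷ʳ_; foldr; lookup)
open import Data.List using (List; []; _∷_)
open import Data.Product using (Σ; _×_; _,_; ∃)
open import Relation.Binary.PropositionalEquality using (_≡_)

module _ (p : ℕ) .{{_ : NonZero p}} where

  𝔽 : Set
  𝔽 = Fin p

  0F : 𝔽
  0F = 0 mod p

  _+F_ : 𝔽 → 𝔽 → 𝔽
  a +F b = (toℕ a ℕ.+ toℕ b) mod p

  _*F_ : 𝔽 → 𝔽 → 𝔽
  a *F b = (toℕ a ℕ.* toℕ b) mod p

  -F_ : 𝔽 → 𝔽
  -F a = (p ∸ toℕ a) mod p

  σ : ∀ {ℓ} → Vec 𝔽 ℓ → 𝔽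
  σ = foldr _ _+F_ 0F

  FVec : ℕ → Set
  FVec m = Fin m → 𝔽

  zeroV : ∀ {m} → FVec m
  zeroV _ = 0F

  _+V_ : ∀ {m} → FVec m → FVec m → FVec m
  (u +V v) i = u i +F v i

  _·V_ : ∀ {m} → 𝔽 → FVec m → FVec m
  (c ·V v) i = c *F v i

  embed : ∀ {m} → Vec Bool m → FVec m
  embed x i with lookup x i
  ... | true  = 1 mod p
  ... | false = 0F

  dot01 : ∀ {m} → Vec 𝔽 m → Vec Bool m → 𝔽
  dot01 [] [] = 0F
  dot01 (c ∷ cs) (true ∷ xs) = c +F dot01 cs xs
  dot01 (c ∷ cs) (false ∷ xs) = dot01 cs xs

  InS : ∀ {m} → Vec 𝔽 m → FVec m → Set
  InS C v = Σ (Vec Bool _) λ x → (dot01 C x ≡ 0F) × (∀ i → embed x i ≡ v i)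

  lincomb : ∀ {m} → List (𝔽 × FVec m) → FVec m
  lincomb [] = zeroV
  lincomb ((c , v) ∷ cvs) = (c ·V v) +V lincomb cvs

  data AllIn {m} (P : FVec m → Set) : List (𝔽 × FVec m) → Set where
    []  : AllIn P []
    _∷_ : ∀ {c v cvs} → P v → AllIn P cvs → AllIn P ((c , v) ∷ cvs)

  InSpan : ∀ {m} → (FVec m → Set) → FVec m → Set
  InSpan P v = Σ (List (𝔽 × FVec _)) λ cvs → AllIn P cvs × (∀ i → lincomb cvs i ≡ v i)

  comb : ∀ {m d} → Vec 𝔽 d → Vec (FVec m) d → FVec m
  comb [] [] = zeroV
  comb (c ∷ cs) (b ∷ bs) = (c ·V b) +V comb cs bs

  LinIndep : ∀ {m d} → Vec (FVec m) d → Set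
  LinIndep {m} {d} bs = (λs : Vec 𝔽 d) → (∀ i → comb λs bs i ≡ 0F) → ∀ j → lookup λs j ≡ 0F

  Spans : ∀ {m d} → Vec (FVec m) d → FVec m → Set
  Spans {d = d} bs v = Σ (Vec 𝔽 d) λ λs → ∀ i → comb λs bs i ≡ v i

  -- the linear span of P has dimension d: it has a basis b_1,…,b_d
  -- (elements of span P, linearly independent, spanning every element of P)
  HasSpanDim : ∀ {m} → (FVec m → Set) → ℕ → Set
  HasSpanDim {m} P d = Σ (Vec (FVec m) d) λ bs →
    (∀ j → InSpan P (lookup bs j)) × LinIndep bs × (∀ v → P v → Spans bs v)

  DimIs : ∀ {m} → Vec 𝔽 m → ℕ → Set
  DimIs C d = HasSpanDim (InS C) d

module Submission where

-- Write (u,0) for u ∈ 𝔽_p^ℓ extended by a zero and 𝟙 for the all-ones vector.  Since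
-- σ(A′) = 0 we have 𝟙 ∈ 𝒮_{A′}, and a 0/1 vector (y,b) lies in 𝒮_{A′} iff b = 0 and y ∈ 𝒮_A,
-- or b = 1 and the complement of y lies in 𝒮_A.  Hence every element of 𝒮_{A′} is (u,0) or
-- 𝟙 − (u,0) with u ∈ 𝒮_A (S′-shape).
--   ⇒  a basis b₁,…,b_d of span 𝒮_A gives the basis 𝟙,(b₁,0),…,(b_d,0) of span 𝒮_{A′};
--   ⇐  the projection w ↦ (wᵢ − w_{ℓ+1})ᵢ maps 𝒮_{A′} onto ±𝒮_A and has kernel the line 𝟙;
--      dropping from a basis of span 𝒮_{A′} a vector that occurs in 𝟙 with nonzero
--      coefficient and projecting the rest gives a basis of span 𝒮_A (DropLine).

open import Defs
open import Level using (0ℓ)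
open import Function using (_∘_)
open import Function.Bundles using (_⇔_; mk⇔)
open import Data.Bool using (Bool; true; false; not)
open import Data.Nat as ℕ using (ℕ; zero; suc; NonZero; _%_; _≥_)
open import Data.Nat.Properties as ℕP using ()
open import Data.Nat.DivMod using (_mod_; m%n<n; %-distribˡ-+; %-distribˡ-*; n%n≡0; m<n⇒m%n≡m; [m+kn]%n≡m%n)
open import Data.Nat.Primality using (Prime; prime⇒nonTrivial)
open import Data.Nat.Coprimality using (coprime-Bézout; prime⇒coprime)
open import Data.Nat.GCD using (module Bézout)
open import Data.Fin as Fin using (Fin; zero; suc; toℕ; punchIn; inject₁; fromℕ)
open import Data.Fin.Properties using (toℕ-injective; toℕ-fromℕ<; toℕ<n; ¬∀⟶∃¬)
open import Data.Fin.Relation.Unary.Top using (view; ‵fromℕ; ‵inject₁)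
open import Data.Vec using (Vec; []; _∷_; _∷ʳ_; lookup; map; zipWith; removeAt; insertAt; replicate; initLast)
open import Data.Vec.Properties using (lookup-map; lookup-replicate; lookup-zipWith; insertAt-lookup; insertAt-punchIn; insertAt-removeAt; removeAt-insertAt)
open import Data.List using (List; []; _∷_)
open import Data.Product using (Σ; _,_; _×_; proj₁; proj₂)
open import Data.Sum using (_⊎_; inj₁; inj₂)
open import Algebra.Bundles using (CommutativeRing)
open import Algebra.Structures using (IsCommutativeRing)
import Algebra.Properties.AbelianGroup as AbelianGroupProperties
import Algebra.Properties.CommutativeSemigroup as CommutativeSemigroupProperties
import Algebra.Properties.Ring as RingProperties
open import Relation.Binary.PropositionalEquality

-- 𝔽_p = Fin p with arithmetic mod p.  Every ring law is transported along the reduction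
-- ⟦_⟧ : ℕ → 𝔽_p, which is a semiring homomorphism with ⟦ toℕ a ⟧ = a.
module PrimeField (p : ℕ) .{{_ : NonZero p}} where
  infixl 6 _+_ _-_
  infixl 7 _*_
  infix 8 -_

  _+_ _*_ _-_ : 𝔽 p → 𝔽 p → 𝔽 p
  _+_ = _+F_ p
  _*_ = _*F_ p
  a - b = a + (-F_ p b)
  -_ : 𝔽 p → 𝔽 p
  -_ = -F_ p
  0# 1# : 𝔽 p
  0# = 0F p
  1# = 1 mod p

  ⟦_⟧ : ℕ → 𝔽 p
  ⟦ n ⟧ = n mod p

  toℕ-⟦⟧ : ∀ n → toℕ ⟦ n ⟧ ≡ n % p
  toℕ-⟦⟧ n = toℕ-fromℕ< (m%n<n n p)

  ⟦⟧-toℕ : ∀ a → ⟦ toℕ a ⟧ ≡ a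
  ⟦⟧-toℕ a = toℕ-injective (trans (toℕ-⟦⟧ (toℕ a)) (m<n⇒m%n≡m (toℕ<n a)))

  ⟦⟧-≡ : ∀ {m n} → m % p ≡ n % p → ⟦ m ⟧ ≡ ⟦ n ⟧
  ⟦⟧-≡ e = toℕ-injective (trans (toℕ-⟦⟧ _) (trans e (sym (toℕ-⟦⟧ _))))

  +-hom : ∀ m n → ⟦ m ⟧ + ⟦ n ⟧ ≡ ⟦ m ℕ.+ n ⟧
  +-hom m n = ⟦⟧-≡ (trans (cong₂ (λ x y → (x ℕ.+ y) % p) (toℕ-⟦⟧ m) (toℕ-⟦⟧ n)) (sym (%-distribˡ-+ m n p)))

  *-hom : ∀ m n → ⟦ m ⟧ * ⟦ n ⟧ ≡ ⟦ m ℕ.* n ⟧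
  *-hom m n = ⟦⟧-≡ (trans (cong₂ (λ x y → (x ℕ.* y) % p) (toℕ-⟦⟧ m) (toℕ-⟦⟧ n)) (sym (%-distribˡ-* m n p)))

  open ≡-Reasoning

  +-assoc : ∀ a b c → (a + b) + c ≡ a + (b + c)
  +-assoc a b c = let x = toℕ a ; y = toℕ b ; z = toℕ c in begin
    ⟦ x ℕ.+ y ⟧ + c          ≡⟨ cong (⟦ x ℕ.+ y ⟧ +_) (⟦⟧-toℕ c) ⟨
    ⟦ x ℕ.+ y ⟧ + ⟦ z ⟧      ≡⟨ +-hom (x ℕ.+ y) z ⟩
    ⟦ x ℕ.+ y ℕ.+ z ⟧        ≡⟨ cong ⟦_⟧ (ℕP.+-assoc x y z) ⟩
    ⟦ x ℕ.+ (y ℕ.+ z) ⟧      ≡⟨ +-hom x (y ℕ.+ z) ⟨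
    ⟦ x ⟧ + ⟦ y ℕ.+ z ⟧      ≡⟨ cong (_+ (b + c)) (⟦⟧-toℕ a) ⟩
    a + (b + c)              ∎

  *-assoc : ∀ a b c → (a * b) * c ≡ a * (b * c)
  *-assoc a b c = let x = toℕ a ; y = toℕ b ; z = toℕ c in begin
    ⟦ x ℕ.* y ⟧ * c          ≡⟨ cong (⟦ x ℕ.* y ⟧ *_) (⟦⟧-toℕ c) ⟨
    ⟦ x ℕ.* y ⟧ * ⟦ z ⟧      ≡⟨ *-hom (x ℕ.* y) z ⟩
    ⟦ x ℕ.* y ℕ.* z ⟧        ≡⟨ cong ⟦_⟧ (ℕP.*-assoc x y z) ⟩
    ⟦ x ℕ.* (y ℕ.* z) ⟧      ≡⟨ *-hom x (y ℕ.* z) ⟨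
    ⟦ x ⟧ * ⟦ y ℕ.* z ⟧      ≡⟨ cong (_* (b * c)) (⟦⟧-toℕ a) ⟩
    a * (b * c)              ∎

  +-comm : ∀ a b → a + b ≡ b + a
  +-comm a b = cong ⟦_⟧ (ℕP.+-comm (toℕ a) (toℕ b))

  *-comm : ∀ a b → a * b ≡ b * a
  *-comm a b = cong ⟦_⟧ (ℕP.*-comm (toℕ a) (toℕ b))

  +-identityˡ : ∀ a → 0# + a ≡ a
  +-identityˡ a = begin
    ⟦ 0 ⟧ + a        ≡⟨ cong (⟦ 0 ⟧ +_) (⟦⟧-toℕ a) ⟨
    ⟦ 0 ⟧ + ⟦ toℕ a ⟧ ≡⟨ +-hom 0 (toℕ a) ⟩
    ⟦ toℕ a ⟧        ≡⟨ ⟦⟧-toℕ a ⟩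
    a                ∎

  *-identityˡ : ∀ a → 1# * a ≡ a
  *-identityˡ a = begin
    ⟦ 1 ⟧ * a         ≡⟨ cong (⟦ 1 ⟧ *_) (⟦⟧-toℕ a) ⟨
    ⟦ 1 ⟧ * ⟦ toℕ a ⟧ ≡⟨ *-hom 1 (toℕ a) ⟩
    ⟦ 1 ℕ.* toℕ a ⟧   ≡⟨ cong ⟦_⟧ (ℕP.*-identityˡ (toℕ a)) ⟩
    ⟦ toℕ a ⟧         ≡⟨ ⟦⟧-toℕ a ⟩
    a                 ∎

  -‿inverseˡ : ∀ a → (- a) + a ≡ 0#
  -‿inverseˡ a = begin
    ⟦ p ℕ.∸ toℕ a ⟧ + a                ≡⟨ cong (⟦ p ℕ.∸ toℕ a ⟧ +_) (⟦⟧-toℕ a) ⟨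
    ⟦ p ℕ.∸ toℕ a ⟧ + ⟦ toℕ a ⟧        ≡⟨ +-hom (p ℕ.∸ toℕ a) (toℕ a) ⟩
    ⟦ p ℕ.∸ toℕ a ℕ.+ toℕ a ⟧          ≡⟨ cong ⟦_⟧ (ℕP.m∸n+n≡m (ℕP.<⇒≤ (toℕ<n a))) ⟩
    ⟦ p ⟧                              ≡⟨ ⟦⟧-≡ (trans (n%n≡0 p) (sym (m<n⇒m%n≡m (ℕ.>-nonZero⁻¹ p)))) ⟩
    ⟦ 0 ⟧                              ∎

  *-distribˡ-+ : ∀ a b c → a * (b + c) ≡ a * b + a * c
  *-distribˡ-+ a b c = let x = toℕ a ; y = toℕ b ; z = toℕ c in begin
    a * ⟦ y ℕ.+ z ⟧                    ≡⟨ cong (_* ⟦ y ℕ.+ z ⟧) (⟦⟧-toℕ a) ⟨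
    ⟦ x ⟧ * ⟦ y ℕ.+ z ⟧                ≡⟨ *-hom x (y ℕ.+ z) ⟩
    ⟦ x ℕ.* (y ℕ.+ z) ⟧                ≡⟨ cong ⟦_⟧ (ℕP.*-distribˡ-+ x y z) ⟩
    ⟦ x ℕ.* y ℕ.+ x ℕ.* z ⟧            ≡⟨ +-hom (x ℕ.* y) (x ℕ.* z) ⟨
    a * b + a * c                      ∎

  isCommutativeRing : IsCommutativeRing _≡_ _+_ _*_ -_ 0# 1#
  isCommutativeRing = record
    { isRing = record
      { +-isAbelianGroup = record
        { isGroup = record
          { isMonoid = record
            { isSemigroup = record
              { isMagma = record { isEquivalence = isEquivalence ; ∙-cong = cong₂ _+_ }
              ; assoc = +-assoc }
            ; identity = +-identityˡ , λ a → trans (+-comm a 0#) (+-identityˡ a) }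
          ; inverse = -‿inverseˡ , λ a → trans (+-comm a (- a)) (-‿inverseˡ a)
          ; ⁻¹-cong = cong (-F_ p) }
        ; comm = +-comm }
      ; *-cong = cong₂ _*_
      ; *-assoc = *-assoc
      ; *-identity = *-identityˡ , λ a → trans (*-comm a 1#) (*-identityˡ a)
      ; distrib = *-distribˡ-+ , λ a b c → trans (*-comm (b + c) a) (trans (*-distribˡ-+ a b c) (cong₂ _+_ (*-comm a b) (*-comm a c))) }
    ; *-comm = *-comm }

  ring : CommutativeRing 0ℓ 0ℓ
  ring = record { isCommutativeRing = isCommutativeRing }

  open CommutativeRing ring public
    using (+-identityʳ; -‿inverseʳ; *-identityʳ; zeroˡ; zeroʳ)
  open AbelianGroupProperties (CommutativeRing.+-abelianGroup ring) public
    using (⁻¹-∙-comm; x∙y⁻¹≈ε⇒x≈y; x≈y⇒x∙y⁻¹≈ε; inverseʳ-unique; ε⁻¹≈ε; ⁻¹-involutive; ∙-cancelˡ)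
  open CommutativeSemigroupProperties (CommutativeRing.+-commutativeSemigroup ring) public
    using (interchange; x∙yz≈y∙xz)
  open RingProperties (CommutativeRing.ring ring) public
    using (-‿distribˡ-*; x[y-z]≈xy-xz; [y-z]x≈yx-zx; -1*x≈-x)

  ⟦m+kp⟧≡⟦m⟧ : ∀ m k → ⟦ m ℕ.+ k ℕ.* p ⟧ ≡ ⟦ m ⟧
  ⟦m+kp⟧≡⟦m⟧ m k = ⟦⟧-≡ ([m+kn]%n≡m%n m k p)

  ⟦m⟧*a≡⟦m*a⟧ : ∀ m a → ⟦ m ⟧ * a ≡ ⟦ m ℕ.* toℕ a ⟧
  ⟦m⟧*a≡⟦m*a⟧ m a = trans (cong (⟦ m ⟧ *_) (sym (⟦⟧-toℕ a))) (*-hom m (toℕ a))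

  x-0#≡x : ∀ x → x - 0# ≡ x
  x-0#≡x x = trans (cong (x +_) ε⁻¹≈ε) (+-identityʳ x)

  toℕ-0# : toℕ 0# ≡ 0
  toℕ-0# = trans (toℕ-⟦⟧ 0) (m<n⇒m%n≡m (ℕ.>-nonZero⁻¹ p))

  nonZero-toℕ : ∀ {a} → a ≢ 0# → NonZero (toℕ a)
  nonZero-toℕ a≢0 = ℕ.≢-nonZero (λ a≡0 → a≢0 (toℕ-injective (trans a≡0 (sym toℕ-0#))))

  module Field (p-prime : Prime p) where

    toℕ-1# : toℕ 1# ≡ 1
    toℕ-1# = trans (toℕ-⟦⟧ 1) (m<n⇒m%n≡m (ℕ.nonTrivial⇒n>1 p {{prime⇒nonTrivial p-prime}}))

    1#≢0# : 1# ≢ 0#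
    1#≢0# 1≡0 with trans (sym toℕ-1#) (trans (cong toℕ 1≡0) toℕ-0#)
    ... | ()

    inverse : ∀ a → a ≢ 0# → Σ (𝔽 p) λ b → b * a ≡ 1#
    inverse a a≢0 with coprime-Bézout (prime⇒coprime p-prime {{nonZero-toℕ a≢0}} (toℕ<n a))
    ... | Bézout.-+ x y eq = ⟦ y ⟧ , (begin
      ⟦ y ⟧ * a               ≡⟨ ⟦m⟧*a≡⟦m*a⟧ y a ⟩
      ⟦ y ℕ.* toℕ a ⟧         ≡⟨ cong ⟦_⟧ eq ⟨
      ⟦ 1 ℕ.+ x ℕ.* p ⟧       ≡⟨ ⟦m+kp⟧≡⟦m⟧ 1 x ⟩
      1#                      ∎)
    ... | Bézout.+- x y eq = - ⟦ y ⟧ , (begin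
      (- ⟦ y ⟧) * a           ≡⟨ -‿distribˡ-* ⟦ y ⟧ a ⟨
      - (⟦ y ⟧ * a)           ≡⟨ cong -_ (inverseʳ-unique 1# (⟦ y ⟧ * a) 1+ya≡0) ⟩
      - (- 1#)                ≡⟨ ⁻¹-involutive 1# ⟩
      1#                      ∎)
      where
      1+ya≡0 : 1# + ⟦ y ⟧ * a ≡ 0#
      1+ya≡0 = begin
        1# + ⟦ y ⟧ * a              ≡⟨ cong (1# +_) (⟦m⟧*a≡⟦m*a⟧ y a) ⟩
        ⟦ 1 ⟧ + ⟦ y ℕ.* toℕ a ⟧     ≡⟨ +-hom 1 (y ℕ.* toℕ a) ⟩
        ⟦ 1 ℕ.+ y ℕ.* toℕ a ⟧       ≡⟨ cong ⟦_⟧ eq ⟩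
        ⟦ x ℕ.* p ⟧                 ≡⟨ ⟦m+kp⟧≡⟦m⟧ 0 x ⟩
        0#                          ∎

    cancel-nonzero : ∀ {t c} → c ≢ 0# → t * c ≡ 0# → t ≡ 0#
    cancel-nonzero {t} {c} c≢0 tc≡0 = begin
      t               ≡⟨ *-identityʳ t ⟨
      t * 1#          ≡⟨ cong (t *_) (trans (*-comm c b) bc≡1) ⟨
      t * (c * b)     ≡⟨ *-assoc t c b ⟨
      (t * c) * b     ≡⟨ cong (_* b) tc≡0 ⟩
      0# * b          ≡⟨ zeroˡ b ⟩
      0#              ∎
      where
      b : 𝔽 p
      b = proj₁ (inverse c c≢0)
      bc≡1 : b * c ≡ 1#
      bc≡1 = proj₂ (inverse c c≢0)

module Vectors (p : ℕ) .{{_ : NonZero p}} where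
  open PrimeField p
  open ≡-Reasoning

  lookup-removeAt : ∀ {n} {X : Set} (xs : Vec X (suc n)) k j → lookup (removeAt xs k) j ≡ lookup xs (punchIn k j)
  lookup-removeAt xs k j = begin
    lookup (removeAt xs k) j                                  ≡⟨ insertAt-punchIn (removeAt xs k) k (lookup xs k) j ⟨
    lookup (insertAt (removeAt xs k) k (lookup xs k)) (punchIn k j) ≡⟨ cong (λ ys → lookup ys (punchIn k j)) (insertAt-removeAt xs k) ⟩
    lookup xs (punchIn k j)                                   ∎

  comb-zero : ∀ {m d} (λs : Vec (𝔽 p) d) (bs : Vec (FVec p m) d) →
              (∀ j → lookup λs j ≡ 0#) → comb p λs bs ≗ zeroV p
  comb-zero [] [] _ i = refl
  comb-zero (c ∷ λs) (b ∷ bs) λs≡0 i = begin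
    c * b i + comb p λs bs i  ≡⟨ cong₂ (λ x y → x * b i + y) (λs≡0 zero) (comb-zero λs bs (λs≡0 ∘ suc) i) ⟩
    0# * b i + 0#             ≡⟨ +-identityʳ (0# * b i) ⟩
    0# * b i                  ≡⟨ zeroˡ (b i) ⟩
    0#                        ∎

  nonzero-coefficient : ∀ {m d} (λs : Vec (𝔽 p) d) (bs : Vec (FVec p m) d) i →
                        comb p λs bs i ≢ 0# → Σ (Fin d) λ k → lookup λs k ≢ 0#
  nonzero-coefficient {d = d} λs bs i comb≢0 =
    ¬∀⟶∃¬ d (λ k → lookup λs k ≡ 0#) (λ k → lookup λs k Fin.≟ 0#) (λ λs≡0 → comb≢0 (comb-zero λs bs λs≡0 i))

  +-minus-interchange : ∀ a b c d → (a + b) - (c + d) ≡ (a - c) + (b - d)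
  +-minus-interchange a b c d = begin
    (a + b) + - (c + d)     ≡⟨ cong ((a + b) +_) (⁻¹-∙-comm c d) ⟨
    (a + b) + (- c + - d)   ≡⟨ interchange a b (- c) (- d) ⟩
    (a - c) + (b - d)       ∎

  comb-sub : ∀ {m d} (α β : Vec (𝔽 p) d) (bs : Vec (FVec p m) d) i →
             comb p (zipWith _-_ α β) bs i ≡ comb p α bs i - comb p β bs i
  comb-sub [] [] [] i = sym (-‿inverseʳ 0#)
  comb-sub (a ∷ α) (b ∷ β) (v ∷ bs) i = begin
    (a - b) * v i + comb p (zipWith _-_ α β) bs i            ≡⟨ cong₂ _+_ ([y-z]x≈yx-zx (v i) a b) (comb-sub α β bs i) ⟩
    (a * v i - b * v i) + (comb p α bs i - comb p β bs i)    ≡⟨ +-minus-interchange (a * v i) (comb p α bs i) (b * v i) (comb p β bs i) ⟨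
    (a * v i + comb p α bs i) - (b * v i + comb p β bs i)    ∎

  comb-scale : ∀ {m d} t (μ : Vec (𝔽 p) d) (bs : Vec (FVec p m) d) i →
               comb p (map (t *_) μ) bs i ≡ t * comb p μ bs i
  comb-scale t [] [] i = sym (zeroʳ t)
  comb-scale t (c ∷ μ) (b ∷ bs) i = begin
    (t * c) * b i + comb p (map (t *_) μ) bs i   ≡⟨ cong₂ _+_ (*-assoc t c (b i)) (comb-scale t μ bs i) ⟩
    t * (c * b i) + t * comb p μ bs i            ≡⟨ *-distribˡ-+ t (c * b i) (comb p μ bs i) ⟨
    t * (c * b i + comb p μ bs i)                ∎

  comb-removeAt : ∀ {m d} (λs : Vec (𝔽 p) (suc d)) (bs : Vec (FVec p m) (suc d)) k →
    lookup λs k ≡ 0# → comb p (removeAt λs k) (removeAt bs k) ≗ comb p λs bs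
  comb-removeAt (c ∷ λs) (b ∷ bs) zero c≡0 i = sym (begin
    c * b i + comb p λs bs i   ≡⟨ cong (λ x → x * b i + comb p λs bs i) c≡0 ⟩
    0# * b i + comb p λs bs i  ≡⟨ cong (_+ comb p λs bs i) (zeroˡ (b i)) ⟩
    0# + comb p λs bs i        ≡⟨ +-identityˡ (comb p λs bs i) ⟩
    comb p λs bs i             ∎)
  comb-removeAt (c ∷ λs@(_ ∷ _)) (b ∷ bs@(_ ∷ _)) (suc k) λₖ≡0 i = cong (c * b i +_) (comb-removeAt λs bs k λₖ≡0 i)

  coefficients-unique : ∀ {m d} {bs : Vec (FVec p m) d} → LinIndep p bs →
    ∀ α β → comb p α bs ≗ comb p β bs → ∀ j → lookup α j ≡ lookup β j
  coefficients-unique {bs = bs} independent α β α≗β j =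
    x∙y⁻¹≈ε⇒x≈y _ _ (trans (sym (lookup-zipWith _-_ j α β)) (independent (zipWith _-_ α β) difference≡0 j))
    where
    difference≡0 : ∀ i → comb p (zipWith _-_ α β) bs i ≡ 0#
    difference≡0 i = trans (comb-sub α β bs i) (x≈y⇒x∙y⁻¹≈ε (α≗β i))

  Spans-cong : ∀ {m d} {bs : Vec (FVec p m) d} {v w} → v ≗ w → Spans p bs v → Spans p bs w
  Spans-cong v≗w (λs , λs≗v) = λs , λ i → trans (λs≗v i) (v≗w i)

  record Linear (m n : ℕ) : Set where
    field
      apply      : FVec p m → FVec p n
      apply-cong : ∀ {v w} → v ≗ w → apply v ≗ apply w
      apply-zero : apply (zeroV p) ≗ zeroV p
      apply-lin  : ∀ c v w → apply (_+V_ p (_·V_ p c v) w) ≗ λ i → c * apply v i + apply w i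
  open Linear public

  comb-map : ∀ {m n d} (f : Linear m n) (λs : Vec (𝔽 p) d) (bs : Vec (FVec p m) d) →
             comb p λs (map (apply f) bs) ≗ apply f (comb p λs bs)
  comb-map f [] [] i = sym (apply-zero f i)
  comb-map f (c ∷ λs) (b ∷ bs) i =
    trans (cong (c * apply f b i +_) (comb-map f λs bs i)) (sym (apply-lin f c b (comb p λs bs) i))

  span-map : ∀ {m n} {P : FVec p m → Set} {Q : FVec p n → Set} (f : Linear m n) →
    (∀ v → P v → Σ (𝔽 p) λ s → Σ (FVec p n) λ u → Q u × apply f v ≗ (λ i → s * u i)) →
    ∀ v → InSpan p P v → InSpan p Q (apply f v)
  span-map {m} {n} {P} {Q} f f[P]⊆Q v (cvs , cvs∈P , cvs≗v) =
    let (cvs′ , cvs′∈Q , cvs′≗fv) = image cvs cvs∈P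
    in cvs′ , cvs′∈Q , λ i → trans (cvs′≗fv i) (apply-cong f cvs≗v i)
    where
    image : ∀ cvs → AllIn p P cvs →
      Σ (List (𝔽 p × FVec p n)) λ cvs′ → AllIn p Q cvs′ × lincomb p cvs′ ≗ apply f (lincomb p cvs)
    image [] [] = [] , [] , λ i → sym (apply-zero f i)
    image ((c , w) ∷ cvs) (w∈P ∷ cvs∈P) =
      let (s , u , u∈Q , fw≗su) = f[P]⊆Q w w∈P
          (cvs′ , cvs′∈Q , cvs′≗f) = image cvs cvs∈P
      in ((c * s , u) ∷ cvs′) , (u∈Q ∷ cvs′∈Q) , λ i → begin
        (c * s) * u i + lincomb p cvs′ i   ≡⟨ cong₂ _+_ (trans (*-assoc c s (u i)) (cong (c *_) (sym (fw≗su i)))) (cvs′≗f i) ⟩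
        c * apply f w i + apply f (lincomb p cvs) i ≡⟨ apply-lin f c w (lincomb p cvs) i ⟨
        apply f (lincomb p ((c , w) ∷ cvs)) i ∎

  -- If μₖ ≠ 0, then the images of the bⱼ
  -- with j ≠ k are independent and span f(span bs): this is how a basis of f(V) is read off
  -- from a basis of V when f is a projection with one-dimensional kernel inside V.
  module DropLine (p-prime : Prime p) {m n d} (f : Linear m n)
      (bs : Vec (FVec p m) (suc d)) (independent : LinIndep p bs)
      (μ : Vec (𝔽 p) (suc d)) (k : Fin (suc d)) (μₖ≢0 : lookup μ k ≢ 0#)
      (f[e]≡0 : apply f (comb p μ bs) ≗ zeroV p)
      (kernel⊆line : ∀ w → apply f w ≗ zeroV p → Σ (𝔽 p) λ t → w ≗ λ i → t * comb p μ bs i) where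
    open PrimeField.Field p p-prime

    fbs : Vec (FVec p n) (suc d)
    fbs = map (apply f) bs

    images : Vec (FVec p n) d
    images = removeAt fbs k

    comb-images : ∀ α → lookup α k ≡ 0# → comb p (removeAt α k) images ≗ apply f (comb p α bs)
    comb-images α αₖ≡0 i = trans (comb-removeAt α fbs k αₖ≡0 i) (comb-map f α bs i)

    images-independent : LinIndep p images
    images-independent ν ν≡0 j = begin
      lookup ν j                     ≡⟨ insertAt-punchIn ν k 0# j ⟨
      lookup α (punchIn k j)         ≡⟨ α≡tμ (punchIn k j) ⟩
      lookup (map (t *_) μ) (punchIn k j) ≡⟨ lookup-map (punchIn k j) (t *_) μ ⟩
      t * lookup μ (punchIn k j)     ≡⟨ cong (_* lookup μ (punchIn k j)) t≡0 ⟩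
      0# * lookup μ (punchIn k j)    ≡⟨ zeroˡ _ ⟩
      0#                             ∎
      where
      α : Vec (𝔽 p) (suc d)
      α = insertAt ν k 0#
      f[α]≡0 : apply f (comb p α bs) ≗ zeroV p
      f[α]≡0 i = begin
        apply f (comb p α bs) i            ≡⟨ comb-images α (insertAt-lookup ν k 0#) i ⟨
        comb p (removeAt α k) images i     ≡⟨ cong (λ β → comb p β images i) (removeAt-insertAt ν k 0#) ⟩
        comb p ν images i                  ≡⟨ ν≡0 i ⟩
        0#                                 ∎
      t : 𝔽 p
      t = proj₁ (kernel⊆line (comb p α bs) f[α]≡0)
      α≡tμ : ∀ j → lookup α j ≡ lookup (map (t *_) μ) j
      α≡tμ = coefficients-unique independent α (map (t *_) μ)
        λ i → trans (proj₂ (kernel⊆line (comb p α bs) f[α]≡0) i) (sym (comb-scale t μ bs i))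
      t≡0 : t ≡ 0#
      t≡0 = cancel-nonzero μₖ≢0 (sym (begin
        0#                   ≡⟨ insertAt-lookup ν k 0# ⟨
        lookup α k           ≡⟨ α≡tμ k ⟩
        lookup (map (t *_) μ) k ≡⟨ lookup-map k (t *_) μ ⟩
        t * lookup μ k       ∎))

    images-span : ∀ λs → Spans p images (apply f (comb p λs bs))
    images-span λs = removeAt λ′ k , λ i → begin
      comb p (removeAt λ′ k) images i             ≡⟨ comb-images λ′ λ′ₖ≡0 i ⟩
      apply f (comb p λ′ bs) i                    ≡⟨ comb-map f λ′ bs i ⟨
      comb p λ′ fbs i                             ≡⟨ comb-sub λs (map (s *_) μ) fbs i ⟩
      comb p λs fbs i - comb p (map (s *_) μ) fbs i ≡⟨ cong (λ x → comb p λs fbs i - x) (comb-scale s μ fbs i) ⟩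
      comb p λs fbs i - s * comb p μ fbs i        ≡⟨ cong (λ x → comb p λs fbs i - s * x) (f[μ]≡0 i) ⟩
      comb p λs fbs i - s * 0#                    ≡⟨ cong (λ x → comb p λs fbs i - x) (zeroʳ s) ⟩
      comb p λs fbs i - 0#                        ≡⟨ x-0#≡x (comb p λs fbs i) ⟩
      comb p λs fbs i                             ≡⟨ comb-map f λs bs i ⟩
      apply f (comb p λs bs) i                    ∎
      where
      f[μ]≡0 : comb p μ fbs ≗ zeroV p
      f[μ]≡0 i = trans (comb-map f μ bs i) (f[e]≡0 i)
      -- subtracting s·μ with s = λₖ/μₖ kills the k-th coefficient
      μₖ⁻¹ : 𝔽 p
      μₖ⁻¹ = proj₁ (inverse (lookup μ k) μₖ≢0)
      s : 𝔽 p
      s = lookup λs k * μₖ⁻¹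
      λ′ : Vec (𝔽 p) (suc d)
      λ′ = zipWith _-_ λs (map (s *_) μ)
      λ′ₖ≡0 : lookup λ′ k ≡ 0#
      λ′ₖ≡0 = begin
        lookup λ′ k                            ≡⟨ lookup-zipWith _-_ k λs (map (s *_) μ) ⟩
        lookup λs k - lookup (map (s *_) μ) k  ≡⟨ cong (λ x → lookup λs k - x) (lookup-map k (s *_) μ) ⟩
        lookup λs k - s * lookup μ k           ≡⟨ cong (λ x → lookup λs k - x) sμₖ≡λₖ ⟩
        lookup λs k - lookup λs k              ≡⟨ -‿inverseʳ (lookup λs k) ⟩
        0#                                     ∎
        where
        sμₖ≡λₖ : s * lookup μ k ≡ lookup λs k
        sμₖ≡λₖ = begin
          (lookup λs k * μₖ⁻¹) * lookup μ k  ≡⟨ *-assoc (lookup λs k) μₖ⁻¹ (lookup μ k) ⟩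
          lookup λs k * (μₖ⁻¹ * lookup μ k)  ≡⟨ cong (lookup λs k *_) (proj₂ (inverse (lookup μ k) μₖ≢0)) ⟩
          lookup λs k * 1#                   ≡⟨ *-identityʳ (lookup λs k) ⟩
          lookup λs k                        ∎

module LastCoordinate (p : ℕ) .{{_ : NonZero p}} where
  open PrimeField p
  open Vectors p
  open ≡-Reasoning

  ≗-by-last : ∀ {n} {v w : FVec p (suc n)} →
              (∀ j → v (inject₁ j) ≡ w (inject₁ j)) → v (fromℕ n) ≡ w (fromℕ n) → v ≗ w
  ≗-by-last v≡w-init v≡w-last i with view i
  ... | ‵fromℕ     = v≡w-last
  ... | ‵inject₁ j = v≡w-init j

  _▹_ : ∀ {n} → FVec p n → 𝔽 p → FVec p (suc n)
  _▹_ {zero}  u a _       = a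
  _▹_ {suc n} u a zero    = u zero
  _▹_ {suc n} u a (suc i) = ((u ∘ suc) ▹ a) i

  ▹-init : ∀ {n} (u : FVec p n) a j → (u ▹ a) (inject₁ j) ≡ u j
  ▹-init u a zero    = refl
  ▹-init u a (suc j) = ▹-init (u ∘ suc) a j

  ▹-last : ∀ {n} (u : FVec p n) a → (u ▹ a) (fromℕ n) ≡ a
  ▹-last {zero}  u a = refl
  ▹-last {suc n} u a = ▹-last (u ∘ suc) a

  ones : ∀ {n} → FVec p n
  ones _ = 1#

  extend : ∀ {n} → Linear n (suc n)
  extend {n} = record
    { apply      = λ u → u ▹ 0#
    ; apply-cong = λ {u} {v} u≗v → ≗-by-last (λ j → trans (▹-init u 0# j) (trans (u≗v j) (sym (▹-init v 0# j))))
                                              (trans (▹-last u 0#) (sym (▹-last v 0#)))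
    ; apply-zero = ≗-by-last (λ j → ▹-init (zeroV p) 0# j) (▹-last {n} (zeroV p) 0#)
    ; apply-lin  = λ c u v → ≗-by-last
        (λ j → trans (▹-init (_+V_ p (_·V_ p c u) v) 0# j) (sym (cong₂ (λ x y → c * x + y) (▹-init u 0# j) (▹-init v 0# j))))
        (trans (▹-last (_+V_ p (_·V_ p c u) v) 0#) (sym (begin
          c * (u ▹ 0#) (fromℕ n) + (v ▹ 0#) (fromℕ n) ≡⟨ cong₂ (λ x y → c * x + y) (▹-last u 0#) (▹-last v 0#) ⟩
          c * 0# + 0#                               ≡⟨ +-identityʳ (c * 0#) ⟩
          c * 0#                                    ≡⟨ zeroʳ c ⟩
          0#                                        ∎)))
    }

  project : ∀ {n} → Linear (suc n) n
  project {n} = record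
    { apply      = λ w i → w (inject₁ i) - w (fromℕ n)
    ; apply-cong = λ v≗w i → cong₂ _-_ (v≗w (inject₁ i)) (v≗w (fromℕ n))
    ; apply-zero = λ i → -‿inverseʳ 0#
    ; apply-lin  = λ c v w i → let x = v (inject₁ i) ; y = v (fromℕ n) in begin
        (c * x + w (inject₁ i)) - (c * y + w (fromℕ n))       ≡⟨ +-minus-interchange (c * x) (w (inject₁ i)) (c * y) (w (fromℕ n)) ⟩
        (c * x - c * y) + (w (inject₁ i) - w (fromℕ n))        ≡⟨ cong (_+ (w (inject₁ i) - w (fromℕ n))) (x[y-z]≈xy-xz c x y) ⟨
        c * (x - y) + (w (inject₁ i) - w (fromℕ n))            ∎
    }

  project-extend : ∀ {n} (u : FVec p n) → apply project (apply extend u) ≗ u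
  project-extend {n} u i = trans (cong₂ _-_ (▹-init u 0# i) (▹-last u 0#)) (x-0#≡x (u i))

  project-ones : ∀ {n} → apply (project {n}) ones ≗ zeroV p
  project-ones i = -‿inverseʳ 1#

  project-kernel : ∀ {n} (w : FVec p (suc n)) → apply project w ≗ zeroV p → w ≗ λ i → w (fromℕ n) * ones i
  project-kernel {n} w pw≡0 = ≗-by-last
    (λ j → trans (x∙y⁻¹≈ε⇒x≈y (w (inject₁ j)) (w (fromℕ n)) (pw≡0 j)) (sym (*-identityʳ (w (fromℕ n)))))
    (sym (*-identityʳ (w (fromℕ n))))

  complement : ∀ {n} → FVec p n → FVec p (suc n)
  complement u i = 1# - apply extend u i

  project-complement : ∀ {n} (u : FVec p n) → apply project (complement u) ≗ λ i → - 1# * u i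
  project-complement {n} u i = begin
    (1# - (u ▹ 0#) (inject₁ i)) - (1# - (u ▹ 0#) (fromℕ n)) ≡⟨ cong₂ (λ x y → (1# - x) - (1# - y)) (▹-init u 0# i) (▹-last u 0#) ⟩
    (1# - u i) - (1# - 0#)         ≡⟨ +-minus-interchange 1# (- u i) 1# (- 0#) ⟩
    (1# - 1#) + (- u i - - 0#)     ≡⟨ cong₂ _+_ (-‿inverseʳ 1#) (cong (λ x → - u i - x) ε⁻¹≈ε) ⟩
    0# + (- u i - 0#)              ≡⟨ +-identityˡ _ ⟩
    - u i - 0#                     ≡⟨ x-0#≡x (- u i) ⟩
    - u i                          ≡⟨ -1*x≈-x (u i) ⟨
    - 1# * u i                     ∎

module ZeroOne (p : ℕ) .{{_ : NonZero p}} where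
  open PrimeField p
  open LastCoordinate p
  open ≡-Reasoning

  bit : Bool → 𝔽 p
  bit true  = 1#
  bit false = 0#

  bit-not : ∀ b → bit b ≡ 1# - bit (not b)
  bit-not true  = sym (x-0#≡x 1#)
  bit-not false = sym (-‿inverseʳ 1#)

  embed-lookup : ∀ {n} (x : Vec Bool n) i → embed p x i ≡ bit (lookup x i)
  embed-lookup x i with lookup x i
  ... | true  = refl
  ... | false = refl

  lookup-∷ʳ-init : ∀ {n} {X : Set} (xs : Vec X n) x j → lookup (xs ∷ʳ x) (inject₁ j) ≡ lookup xs j
  lookup-∷ʳ-init (_ ∷ _)  x zero    = refl
  lookup-∷ʳ-init (_ ∷ xs) x (suc j) = lookup-∷ʳ-init xs x j

  lookup-∷ʳ-last : ∀ {n} {X : Set} (xs : Vec X n) x → lookup (xs ∷ʳ x) (fromℕ n) ≡ x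
  lookup-∷ʳ-last []       x = refl
  lookup-∷ʳ-last (_ ∷ xs) x = lookup-∷ʳ-last xs x

  embed-∷ʳ : ∀ {n} (y : Vec Bool n) b → embed p (y ∷ʳ b) ≗ (embed p y ▹ bit b)
  embed-∷ʳ {n} y b = ≗-by-last
    (λ j → begin
      embed p (y ∷ʳ b) (inject₁ j)        ≡⟨ embed-lookup (y ∷ʳ b) (inject₁ j) ⟩
      bit (lookup (y ∷ʳ b) (inject₁ j))   ≡⟨ cong bit (lookup-∷ʳ-init y b j) ⟩
      bit (lookup y j)                    ≡⟨ embed-lookup y j ⟨
      embed p y j                         ≡⟨ ▹-init (embed p y) (bit b) j ⟨
      (embed p y ▹ bit b) (inject₁ j)     ∎)
    (begin
      embed p (y ∷ʳ b) (fromℕ n)          ≡⟨ embed-lookup (y ∷ʳ b) (fromℕ n) ⟩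
      bit (lookup (y ∷ʳ b) (fromℕ n))     ≡⟨ cong bit (lookup-∷ʳ-last y b) ⟩
      bit b                               ≡⟨ ▹-last (embed p y) (bit b) ⟨
      (embed p y ▹ bit b) (fromℕ n)       ∎)

  embed-all : ∀ {n} → embed p (replicate n true) ≗ ones
  embed-all i = trans (embed-lookup (replicate _ true) i) (cong bit (lookup-replicate i true))

  σ-∷ʳ : ∀ {n} (C : Vec (𝔽 p) n) c → σ p (C ∷ʳ c) ≡ σ p C + c
  σ-∷ʳ []      c = trans (+-identityʳ c) (sym (+-identityˡ c))
  σ-∷ʳ (a ∷ C) c = trans (cong (a +_) (σ-∷ʳ C c)) (sym (+-assoc a (σ p C) c))

  dot01-∷ʳ-false : ∀ {n} (C : Vec (𝔽 p) n) c x → dot01 p (C ∷ʳ c) (x ∷ʳ false) ≡ dot01 p C x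
  dot01-∷ʳ-false []      c []           = refl
  dot01-∷ʳ-false (a ∷ C) c (true ∷ x)  = cong (a +_) (dot01-∷ʳ-false C c x)
  dot01-∷ʳ-false (a ∷ C) c (false ∷ x) = dot01-∷ʳ-false C c x

  dot01-∷ʳ-true : ∀ {n} (C : Vec (𝔽 p) n) c x → dot01 p (C ∷ʳ c) (x ∷ʳ true) ≡ dot01 p C x + c
  dot01-∷ʳ-true []      c []           = trans (+-identityʳ c) (sym (+-identityˡ c))
  dot01-∷ʳ-true (a ∷ C) c (true ∷ x)  = trans (cong (a +_) (dot01-∷ʳ-true C c x)) (sym (+-assoc a (dot01 p C x) c))
  dot01-∷ʳ-true (a ∷ C) c (false ∷ x) = dot01-∷ʳ-true C c x

  dot01-not : ∀ {n} (C : Vec (𝔽 p) n) x → dot01 p C x + dot01 p C (map not x) ≡ σ p C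
  dot01-not []      []          = +-identityˡ 0#
  dot01-not (a ∷ C) (true ∷ x)  = trans (+-assoc a _ _) (cong (a +_) (dot01-not C x))
  dot01-not (a ∷ C) (false ∷ x) = begin
    dot01 p C x + (a + dot01 p C (map not x)) ≡⟨ x∙yz≈y∙xz (dot01 p C x) a _ ⟩
    a + (dot01 p C x + dot01 p C (map not x)) ≡⟨ cong (a +_) (dot01-not C x) ⟩
    a + σ p C                                 ∎

  dot01-all : ∀ {n} (C : Vec (𝔽 p) n) → dot01 p C (replicate n true) ≡ σ p C
  dot01-all []      = refl
  dot01-all (a ∷ C) = cong (a +_) (dot01-all C)

module Extension (p : ℕ) .{{_ : NonZero p}} {ℓ : ℕ} (A : Vec (𝔽 p) ℓ) where
  open PrimeField p
  open Vectors p
  open LastCoordinate p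
  open ZeroOne p
  open ≡-Reasoning

  A′ : Vec (𝔽 p) (suc ℓ)
  A′ = A ∷ʳ (- σ p A)

  σ-A′ : σ p A′ ≡ 0#
  σ-A′ = trans (σ-∷ʳ A (- σ p A)) (-‿inverseʳ (σ p A))

  ones∈S′ : InS p A′ ones
  ones∈S′ = replicate (suc ℓ) true , trans (dot01-all A′) σ-A′ , embed-all

  extend∈S′ : ∀ {u} → InS p A u → InS p A′ (apply extend u)
  extend∈S′ (y , y∈S , y≗u) =
    (y ∷ʳ false) , trans (dot01-∷ʳ-false A (- σ p A) y) y∈S , λ i → trans (embed-∷ʳ y false i) (apply-cong extend y≗u i)

  -- x ∈ 𝒮_{A′} with last bit 1 means ∑ aᵢxᵢ = σ(A), so the complementary bits lie in 𝒮_A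
  complement∈S : ∀ y → dot01 p A′ (y ∷ʳ true) ≡ 0# → dot01 p A (map not y) ≡ 0#
  complement∈S y y∈S′ = ∙-cancelˡ (dot01 p A y) (dot01 p A (map not y)) 0# (begin
    dot01 p A y + dot01 p A (map not y)   ≡⟨ dot01-not A y ⟩
    σ p A                                 ≡⟨ dot01≡σ ⟨
    dot01 p A y                           ≡⟨ +-identityʳ (dot01 p A y) ⟨
    dot01 p A y + 0#                      ∎)
    where
    dot01≡σ : dot01 p A y ≡ σ p A
    dot01≡σ = x∙y⁻¹≈ε⇒x≈y (dot01 p A y) (σ p A) (trans (sym (dot01-∷ʳ-true A (- σ p A) y)) y∈S′)

  embed-complement : ∀ y → (embed p y ▹ 1#) ≗ complement (embed p (map not y))
  embed-complement y = ≗-by-last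
    (λ j → begin
      (embed p y ▹ 1#) (inject₁ j)                       ≡⟨ ▹-init (embed p y) 1# j ⟩
      embed p y j                                        ≡⟨ embed-lookup y j ⟩
      bit (lookup y j)                                   ≡⟨ bit-not (lookup y j) ⟩
      1# - bit (not (lookup y j))                        ≡⟨ cong (λ b → 1# - bit b) (lookup-map j not y) ⟨
      1# - bit (lookup (map not y) j)                    ≡⟨ cong (λ x → 1# - x) (embed-lookup (map not y) j) ⟨
      1# - embed p (map not y) j                         ≡⟨ cong (λ x → 1# - x) (▹-init (embed p (map not y)) 0# j) ⟨
      complement (embed p (map not y)) (inject₁ j)       ∎)
    (begin
      (embed p y ▹ 1#) (fromℕ ℓ)                         ≡⟨ ▹-last (embed p y) 1# ⟩
      1#                                                 ≡⟨ x-0#≡x 1# ⟨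
      1# - 0#                                            ≡⟨ cong (λ x → 1# - x) (▹-last (embed p (map not y)) 0#) ⟨
      complement (embed p (map not y)) (fromℕ ℓ)         ∎)

  S′-shape : ∀ {v} → InS p A′ v → Σ (FVec p ℓ) λ u → InS p A u × (v ≗ apply extend u ⊎ v ≗ complement u)
  S′-shape (x , x∈S′ , x≗v) with initLast x
  ... | y , false , refl = embed p y , (y , trans (sym (dot01-∷ʳ-false A (- σ p A) y)) x∈S′ , λ _ → refl) ,
        inj₁ λ i → trans (sym (x≗v i)) (embed-∷ʳ y false i)
  ... | y , true , refl = embed p (map not y) , (map not y , complement∈S y x∈S′ , λ _ → refl) ,
        inj₂ λ i → trans (sym (x≗v i)) (trans (embed-∷ʳ y true i) (embed-complement y i))

  forward : ∀ d → DimIs p A d → DimIs p A′ (suc d)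
  forward d (bs , bs∈span , independent , spanning) = bs′ , bs′∈span , independent′ , spanning′
    where
    bs′ : Vec (FVec p (suc ℓ)) (suc d)
    bs′ = ones ∷ map (apply extend) bs

    comb-bs′ : ∀ c λs i → comb p (c ∷ λs) bs′ i ≡ c * 1# + apply extend (comb p λs bs) i
    comb-bs′ c λs i = cong (c * 1# +_) (comb-map extend λs bs i)

    bs′∈span : ∀ j → InSpan p (InS p A′) (lookup bs′ j)
    bs′∈span zero    = ((1# , ones) ∷ []) , (ones∈S′ ∷ []) , λ i → trans (+-identityʳ (1# * 1#)) (*-identityʳ 1#)
    bs′∈span (suc j) = subst (InSpan p (InS p A′)) (sym (lookup-map j (apply extend) bs))
      (span-map extend (λ u u∈S → 1# , apply extend u , extend∈S′ u∈S , λ i → sym (*-identityˡ _)) (lookup bs j) (bs∈span j))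

    independent′ : LinIndep p bs′
    independent′ (c ∷ λs) comb≡0 = λ { zero → c≡0 ; (suc j) → independent λs λs≡0 j }
      where
      -- the last coordinate sees only the coefficient of ones
      c≡0 : c ≡ 0#
      c≡0 = begin
        c                                              ≡⟨ *-identityʳ c ⟨
        c * 1#                                         ≡⟨ +-identityʳ (c * 1#) ⟨
        c * 1# + 0#                                    ≡⟨ cong (c * 1# +_) (▹-last (comb p λs bs) 0#) ⟨
        c * 1# + apply extend (comb p λs bs) (fromℕ ℓ) ≡⟨ comb-bs′ c λs (fromℕ ℓ) ⟨
        comb p (c ∷ λs) bs′ (fromℕ ℓ)                  ≡⟨ comb≡0 (fromℕ ℓ) ⟩
        0#                                             ∎
      λs≡0 : ∀ i → comb p λs bs i ≡ 0#
      λs≡0 i = begin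
        comb p λs bs i                                  ≡⟨ ▹-init (comb p λs bs) 0# i ⟨
        apply extend (comb p λs bs) (inject₁ i)         ≡⟨ +-identityˡ _ ⟨
        0# + apply extend (comb p λs bs) (inject₁ i)    ≡⟨ cong (_+ apply extend (comb p λs bs) (inject₁ i)) (zeroˡ 1#) ⟨
        0# * 1# + apply extend (comb p λs bs) (inject₁ i) ≡⟨ cong (λ x → x * 1# + apply extend (comb p λs bs) (inject₁ i)) c≡0 ⟨
        c * 1# + apply extend (comb p λs bs) (inject₁ i) ≡⟨ comb-bs′ c λs (inject₁ i) ⟨
        comb p (c ∷ λs) bs′ (inject₁ i)                 ≡⟨ comb≡0 (inject₁ i) ⟩
        0#                                              ∎

    spanning′ : ∀ v → InS p A′ v → Spans p bs′ v
    spanning′ v v∈S′ with S′-shape v∈S′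
    ... | u , u∈S , inj₁ v≗u0 =
      let (λs , λs≗u) = spanning u u∈S in (0# ∷ λs) , λ i → begin
        comb p (0# ∷ λs) bs′ i                          ≡⟨ comb-bs′ 0# λs i ⟩
        0# * 1# + apply extend (comb p λs bs) i         ≡⟨ cong (_+ apply extend (comb p λs bs) i) (zeroˡ 1#) ⟩
        0# + apply extend (comb p λs bs) i              ≡⟨ +-identityˡ _ ⟩
        apply extend (comb p λs bs) i                   ≡⟨ apply-cong extend λs≗u i ⟩
        apply extend u i                                ≡⟨ v≗u0 i ⟨
        v i                                             ∎
    ... | u , u∈S , inj₂ v≗1-u0 =
      let (λs , λs≗u) = spanning u u∈S in (1# ∷ map (- 1# *_) λs) , λ i → begin
        1# * 1# + comb p (map (- 1# *_) λs) (map (apply extend) bs) i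
          ≡⟨ cong₂ _+_ (*-identityʳ 1#) (comb-scale (- 1#) λs (map (apply extend) bs) i) ⟩
        1# + - 1# * comb p λs (map (apply extend) bs) i
          ≡⟨ cong (λ x → 1# + - 1# * x) (trans (comb-map extend λs bs i) (apply-cong extend λs≗u i)) ⟩
        1# + - 1# * apply extend u i                          ≡⟨ cong (1# +_) (-1*x≈-x (apply extend u i)) ⟩
        1# - apply extend u i                                 ≡⟨ v≗1-u0 i ⟨
        v i                                                   ∎

  project-multiple : ∀ v → InS p A′ v →
    Σ (𝔽 p) λ s → Σ (FVec p ℓ) λ u → InS p A u × apply project v ≗ (λ i → s * u i)
  project-multiple v v∈S′ with S′-shape v∈S′
  ... | u , u∈S , inj₁ v≗u0 = 1# , u , u∈S , λ i →
    trans (apply-cong project v≗u0 i) (trans (project-extend u i) (sym (*-identityˡ (u i))))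
  ... | u , u∈S , inj₂ v≗1-u0 = - 1# , u , u∈S , λ i →
    trans (apply-cong project v≗1-u0 i) (project-complement u i)

  -- a basis of A′ contains ones in its span with some coefficient μₖ ≠ 0; projecting the
  -- other basis vectors along ones gives a basis for A
  backward : Prime p → ∀ d → DimIs p A′ (suc d) → DimIs p A d
  backward p-prime d (bs′ , bs′∈span , independent′ , spanning′) = images , images∈span , images-independent , spanning
    where
    open PrimeField.Field p p-prime using (1#≢0#)
    μ : Vec (𝔽 p) (suc d)
    μ = proj₁ (spanning′ ones ones∈S′)
    μ≗ones : comb p μ bs′ ≗ ones
    μ≗ones = proj₂ (spanning′ ones ones∈S′)
    -- μ has a nonzero coefficient since the last coordinate of ones is 1 ≠ 0
    nonzero : Σ (Fin (suc d)) λ k → lookup μ k ≢ 0#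
    nonzero = nonzero-coefficient μ bs′ (fromℕ ℓ) (λ ones≡0 → 1#≢0# (trans (sym (μ≗ones (fromℕ ℓ))) ones≡0))
    k : Fin (suc d)
    k = proj₁ nonzero
    open DropLine p-prime project bs′ independent′ μ k (proj₂ nonzero)
      (λ i → trans (apply-cong project μ≗ones i) (project-ones i))
      (λ w pw≡0 → w (fromℕ ℓ) , λ i → trans (project-kernel w pw≡0 i) (cong (w (fromℕ ℓ) *_) (sym (μ≗ones i))))

    images∈span : ∀ j → InSpan p (InS p A) (lookup images j)
    images∈span j = subst (InSpan p (InS p A))
      (sym (trans (lookup-removeAt fbs k j) (lookup-map (punchIn k j) (apply project) bs′)))
      (span-map project project-multiple (lookup bs′ (punchIn k j)) (bs′∈span (punchIn k j)))

    spanning : ∀ u → InS p A u → Spans p images u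
    spanning u u∈S =
      let (λs , λs≗u0) = spanning′ (apply extend u) (extend∈S′ u∈S)
      in Spans-cong (λ i → trans (apply-cong project λs≗u0 i) (project-extend u i)) (images-span λs)

lemma5p1 : (p : ℕ) .{{_ : NonZero p}} → Prime p →
    (ℓ : ℕ) → ℓ ≥ 1 → (A : Vec (𝔽 p) ℓ) → (∀ i → lookup A i ≢ 0F p) →
    σ p A ≢ 0F p →
    (σ p (A ∷ʳ (-F_ p (σ p A))) ≡ 0F p) ×
    (∀ d → DimIs p A d ⇔ DimIs p (A ∷ʳ (-F_ p (σ p A))) (suc d))
lemma5p1 p p-prime ℓ _ A _ _ = σ-A′ , λ d → mk⇔ (forward d) (backward p-prime d)
  where open Extension p A
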